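{- Let $m\geq 1$ and $k\geq 0$ be integers, $l=m$, and $n=m+k+l$. Let $M_{mkl}$ be the largest cardinality of a subset $X\subset L_{mkl}$ with $D(X)<D(L_{mkl})$. Then \[ M_{mkl}=\frac12\binom{n}{m}\binom{k+m}{m}=\frac12|L_{mkl}|, \] and the subsets $X\subset L_{mkl}$ with $D(X)<D(L_{mkl})$ and $|X|=M_{mkl}$ are exactly those containing exactly one of $x$ and $-x$ for every $x\in L_{mkl}$.
   Context: For nonnegative integers $m,k,l$, $L_{mkl}\subset\mathbb{R}^{m+k+l}$ denotes the set of vectors having exactly $m$ entries equal to $-1$, $k$ entries equal to $0$ and $l$ entries equal to $1$. For $X\subset\mathbb{R}^n$, $D(X)=\max\{d(x,y)\mid x,y\in X\}$ is its diameter, $d$ the Euclidean distance. -}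

module Defs where

open import Data.Nat using (ℕ; _+_; _*_; _<_)
open import Data.Integer as ℤ using (ℤ; -1ℤ; 0ℤ; 1ℤ; ∣_∣; _-_; -_; _≟_)
open import Data.Vec using (Vec; count; foldr; zipWith; map)
open import Data.List using (List)
open import Data.List.Membership.Propositional using (_∈_)
open import Data.Product using (Σ; ∃; _×_)
open import Data.Sum using (_⊎_)
open import Relation.Binary.PropositionalEquality using (_≡_)
open import Relation.Nullary using (¬_)

-- Membership in L_{mkl} ⊂ ℝ^{m+k+l}, vectors with integer coordinates:
-- exactly m entries -1, k entries 0, l entries 1.
-- (Since m+k+l is the length, all entries lie in {-1,0,1}.)
InL : (m k l : ℕ) → Vec ℤ (m + k + l) → Set
InL m k l v = (count (_≟ -1ℤ) v ≡ m) × (count (_≟ 0ℤ) v ≡ k) × (count (_≟ 1ℤ) v ≡ l)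

sqDist : ∀ {n} → Vec ℤ n → Vec ℤ n → ℕ
sqDist u v = foldr _ _+_ 0 (zipWith (λ a b → ∣ a - b ∣ * ∣ a - b ∣) u v)

neg : ∀ {n} → Vec ℤ n → Vec ℤ n
neg = map (λ a → - a)

-- D(X) < D(L_{mkl}): some pair in L_{mkl} is farther apart than every pair in X
-- (comparing squared distances, sqrt being monotone).
SmallDiam : (m k l : ℕ) → List (Vec ℤ (m + k + l)) → Set
SmallDiam m k l X =
  Σ (Vec ℤ (m + k + l)) λ a → Σ (Vec ℤ (m + k + l)) λ b →
    InL m k l a × InL m k l b ×
    (∀ x y → x ∈ X → y ∈ X → sqDist x y < sqDist a b)

Antipodal1 : (m k l : ℕ) → List (Vec ℤ (m + k + l)) → Set
Antipodal1 m k l X = ∀ x → InL m k l x →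
  ((x ∈ X) × ¬ (neg x ∈ X)) ⊎ (¬ (x ∈ X) × (neg x ∈ X))

module Submission where

-- The parallelogram law |u - v|² + |u + v|² = 2|u|² + 2|v|² gives
-- |u - v|² ≤ 2|u|² + 2|v|² for integer vectors, with equality iff v = -u.
-- All points of L_{mkm} have |u|² = 2m and L_{mkm} = -L_{mkm}, so D(L_{mkm})
-- is attained exactly on antipodal pairs, and D(X) < D(L_{mkm}) means that X
-- contains no pair x, -x.  Then X ++ (-X) is duplicate-free inside L_{mkm},
-- so 2|X| ≤ |L_{mkm}|, with equality iff X meets every pair x, -x.  For
-- m ≥ 1 the points whose first nonzero entry is 1 form such a set.

open import Defs
open import Data.Nat using (ℕ; _+_; _*_; _≤_)
open import Data.Nat.Combinatorics using (_C_)
open import Data.Integer using (ℤ)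
open import Data.Vec using (Vec)
open import Data.List using (List; length)
open import Data.List.Relation.Unary.All using (All)
open import Data.List.Relation.Unary.Unique.Propositional using (Unique)
open import Data.List.Membership.Propositional using (_∈_)
open import Data.Product using (Σ; _×_)
open import Function.Bundles using (_⇔_)
open import Relation.Binary.PropositionalEquality using (_≡_)

open import Data.Nat using (zero; suc; _<_; z≤n; s≤s; NonZero)
open import Data.Nat.Properties
  using ( +-suc; +-comm; +-identityʳ; +-cancelˡ-≡; *-distribˡ-+; *-distribʳ-+
        ; suc-injective; m+n≡0⇒m≡0; m+n≡0⇒n≡0; m≤m+n; m≤n⇒m≤1+n; n<1+n; 1+n≰n
        ; ≤-reflexive; ≤-trans; ≤-antisym; <-irrefl; <⇒≢; <⇒≱; ≤∧≢⇒< )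
open import Data.Nat.Tactic.RingSolver as ℕ-Solver using ()
open import Data.Nat.Combinatorics using (nCn≡1; nCk+nC[k+1]≡[n+1]C[k+1]; k>n⇒nCk≡0)
open import Data.Integer as ℤ using (-[1+_]; -1ℤ; 0ℤ; 1ℤ; ∣_∣; _-_; -_; _≟_)
import Data.Integer.Properties as ℤₚ
open import Data.Integer using () renaming (+_ to pos)
open import Data.Integer.Tactic.RingSolver as ℤ-Solver using ()
open import Data.Vec using ([]; _∷_; head; count)
import Data.Vec.Properties as Vecₚ
import Data.Vec.Relation.Unary.All as VecAll
open VecAll using ([]; _∷_)
open import Data.List using ([]; _∷_; _++_; map; filter)
open import Data.List.Properties using (length-++; length-map)
import Data.List.Relation.Unary.All as ListAll
open ListAll using ([]; _∷_)
import Data.List.Relation.Unary.All.Properties as Allₚ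
open import Data.List.Relation.Unary.Any using (here; there)
open import Data.List.Relation.Unary.AllPairs using ([]; _∷_)
import Data.List.Relation.Unary.Unique.Propositional.Properties as Uniqueₚ
open import Data.List.Relation.Binary.Disjoint.Propositional using (Disjoint)
open import Data.List.Relation.Binary.Subset.Propositional using (_⊆_)
open import Data.List.Membership.Propositional using (_∉_)
open import Data.List.Membership.Propositional.Properties
  using (∈-map⁺; ∈-map⁻; ∈-++⁺ˡ; ∈-++⁺ʳ; ∈-++⁻; ∈-filter⁺; ∈-filter⁻)
import Data.List.Fresh as Fresh
import Data.List.Fresh.Relation.Unary.Any as FreshAny
open import Data.Product using (_,_; proj₁; proj₂)
open import Data.Sum using (_⊎_; inj₁; inj₂; [_,_]′)
open import Data.Bool using (if_then_else_)
open import Data.Empty using (⊥-elim)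
open import Function using (id; _∘_)
open import Function.Bundles using (mk⇔; Equivalence)
open import Relation.Nullary using (yes; no; does; contradiction)
open import Relation.Unary using (Decidable)
open import Relation.Binary.PropositionalEquality
  using (_≢_; refl; sym; trans; cong; cong₂; subst; subst₂; setoid; module ≡-Reasoning)

-- Counting duplicate-free lists.  A duplicate-free list is a fresh list for
-- the relation _≢_, with the same length and members; this transfers the
-- library's pigeonhole results for fresh lists.
module _ {A : Set} where

  import Data.List.Fresh.Membership.Setoid (setoid A) as Fresh∈
  open import Data.List.Fresh.Membership.Setoid.Properties (setoid A)
    using (injection; strict-injection)

  private
    length-fromList : {xs : List A} (u : Unique xs) → Fresh.length (Fresh.fromList u) ≡ length xs
    length-fromList [] = refl
    length-fromList (_ ∷ u) = cong suc (length-fromList u)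

    ∈-fromList⁺ : {xs : List A} (u : Unique xs) → ∀ {x} → x ∈ xs → x Fresh∈.∈ Fresh.fromList u
    ∈-fromList⁺ (_ ∷ u) (here x≡y) = FreshAny.here x≡y
    ∈-fromList⁺ (_ ∷ u) (there x∈xs) = FreshAny.there (∈-fromList⁺ u x∈xs)

    ∈-fromList⁻ : {xs : List A} (u : Unique xs) → ∀ {x} → x Fresh∈.∈ Fresh.fromList u → x ∈ xs
    ∈-fromList⁻ {_ ∷ _} (_ ∷ u) (FreshAny.here x≡y) = here x≡y
    ∈-fromList⁻ {_ ∷ _} (_ ∷ u) (FreshAny.there x∈xs) = there (∈-fromList⁻ u x∈xs)

  unique-⊆-length≤ : {xs ys : List A} → Unique xs → Unique ys → xs ⊆ ys → length xs ≤ length ys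
  unique-⊆-length≤ ux uy xs⊆ys = subst₂ _≤_ (length-fromList ux) (length-fromList uy)
    (injection id (∈-fromList⁺ uy ∘ xs⊆ys ∘ ∈-fromList⁻ ux))

  unique-⊆-length< : {xs ys : List A} → Unique xs → Unique ys → xs ⊆ ys →
                     ∀ {y} → y ∈ ys → y ∉ xs → length xs < length ys
  unique-⊆-length< ux uy xs⊆ys y∈ys y∉xs = subst₂ _<_ (length-fromList ux) (length-fromList uy)
    (strict-injection id (∈-fromList⁺ uy ∘ xs⊆ys ∘ ∈-fromList⁻ ux)
      (_ , ∈-fromList⁺ uy y∈ys , y∉xs ∘ ∈-fromList⁻ ux))

sqNorm : ∀ {n} → Vec ℤ n → ℕ
sqNorm [] = 0
sqNorm (a ∷ u) = ∣ a ∣ * ∣ a ∣ + sqNorm u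

private
  pos∣i∣² : ∀ i → pos (∣ i ∣ * ∣ i ∣) ≡ i ℤ.* i
  pos∣i∣² i with ℤₚ.+∣i∣≡i⊎+∣i∣≡-i i
  ... | inj₁ +∣i∣≡i = trans (ℤₚ.pos-* ∣ i ∣ ∣ i ∣) (cong₂ ℤ._*_ +∣i∣≡i +∣i∣≡i)
  ... | inj₂ +∣i∣≡-i =
    trans (ℤₚ.pos-* ∣ i ∣ ∣ i ∣) (trans (cong₂ ℤ._*_ +∣i∣≡-i +∣i∣≡-i) (square-neg i))
    where
    square-neg : ∀ i → (- i) ℤ.* (- i) ≡ i ℤ.* i
    square-neg = ℤ-Solver.solve-∀

parallelogram₁ : ∀ a b →
  ∣ a - b ∣ * ∣ a - b ∣ + ∣ a - - b ∣ * ∣ a - - b ∣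
    ≡ 2 * (∣ a ∣ * ∣ a ∣) + 2 * (∣ b ∣ * ∣ b ∣)
parallelogram₁ a b = ℤₚ.+-injective (begin
  pos (∣ a - b ∣ * ∣ a - b ∣ + ∣ a - - b ∣ * ∣ a - - b ∣)
    ≡⟨ ℤₚ.pos-+ (∣ a - b ∣ * ∣ a - b ∣) _ ⟩
  pos (∣ a - b ∣ * ∣ a - b ∣) ℤ.+ pos (∣ a - - b ∣ * ∣ a - - b ∣)
    ≡⟨ cong₂ ℤ._+_ (pos∣i∣² (a - b)) (pos∣i∣² (a - - b)) ⟩
  (a - b) ℤ.* (a - b) ℤ.+ (a - - b) ℤ.* (a - - b)
    ≡⟨ identity a b ⟩
  pos 2 ℤ.* (a ℤ.* a) ℤ.+ pos 2 ℤ.* (b ℤ.* b)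
    ≡⟨ cong₂ (λ x y → pos 2 ℤ.* x ℤ.+ pos 2 ℤ.* y) (pos∣i∣² a) (pos∣i∣² b) ⟨
  pos 2 ℤ.* pos (∣ a ∣ * ∣ a ∣) ℤ.+ pos 2 ℤ.* pos (∣ b ∣ * ∣ b ∣)
    ≡⟨ cong₂ ℤ._+_ (ℤₚ.pos-* 2 (∣ a ∣ * ∣ a ∣)) (ℤₚ.pos-* 2 (∣ b ∣ * ∣ b ∣)) ⟨
  pos (2 * (∣ a ∣ * ∣ a ∣)) ℤ.+ pos (2 * (∣ b ∣ * ∣ b ∣))
    ≡⟨ ℤₚ.pos-+ (2 * (∣ a ∣ * ∣ a ∣)) _ ⟨
  pos (2 * (∣ a ∣ * ∣ a ∣) + 2 * (∣ b ∣ * ∣ b ∣)) ∎)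
  where
  open ≡-Reasoning
  identity : ∀ a b → (a - b) ℤ.* (a - b) ℤ.+ (a - - b) ℤ.* (a - - b)
                     ≡ pos 2 ℤ.* (a ℤ.* a) ℤ.+ pos 2 ℤ.* (b ℤ.* b)
  identity = ℤ-Solver.solve-∀

parallelogram : ∀ {n} (u v : Vec ℤ n) → sqDist u v + sqDist u (neg v) ≡ 2 * sqNorm u + 2 * sqNorm v
parallelogram [] [] = refl
parallelogram (a ∷ u) (b ∷ v) = begin
  (∣ a - b ∣ * ∣ a - b ∣ + sqDist u v) + (∣ a - - b ∣ * ∣ a - - b ∣ + sqDist u (neg v))
    ≡⟨ interchange (∣ a - b ∣ * ∣ a - b ∣) (sqDist u v) _ _ ⟩
  (∣ a - b ∣ * ∣ a - b ∣ + ∣ a - - b ∣ * ∣ a - - b ∣) + (sqDist u v + sqDist u (neg v))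
    ≡⟨ cong₂ _+_ (parallelogram₁ a b) (parallelogram u v) ⟩
  (2 * (∣ a ∣ * ∣ a ∣) + 2 * (∣ b ∣ * ∣ b ∣)) + (2 * sqNorm u + 2 * sqNorm v)
    ≡⟨ regroup (∣ a ∣ * ∣ a ∣) (∣ b ∣ * ∣ b ∣) (sqNorm u) (sqNorm v) ⟩
  2 * (∣ a ∣ * ∣ a ∣ + sqNorm u) + 2 * (∣ b ∣ * ∣ b ∣ + sqNorm v) ∎
  where
  open ≡-Reasoning
  interchange : ∀ p q r s → (p + q) + (r + s) ≡ (p + r) + (q + s)
  interchange = ℕ-Solver.solve-∀
  regroup : ∀ p q r s → (2 * p + 2 * q) + (2 * r + 2 * s) ≡ 2 * (p + r) + 2 * (q + s)
  regroup = ℕ-Solver.solve-∀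

sqDist≡0⇒≡ : ∀ {n} (u v : Vec ℤ n) → sqDist u v ≡ 0 → u ≡ v
sqDist≡0⇒≡ [] [] _ = refl
sqDist≡0⇒≡ (a ∷ u) (b ∷ v) eq =
  cong₂ _∷_ (ℤₚ.i-j≡0⇒i≡j a b (ℤₚ.∣i∣≡0⇒i≡0 (square≡0 (m+n≡0⇒m≡0 _ eq))))
            (sqDist≡0⇒≡ u v (m+n≡0⇒n≡0 _ eq))
  where
  square≡0 : ∀ {m} → m * m ≡ 0 → m ≡ 0
  square≡0 {zero} _ = refl

sqDist-self : ∀ {n} (u : Vec ℤ n) → sqDist u u ≡ 0
sqDist-self [] = refl
sqDist-self (a ∷ u) rewrite ℤₚ.+-inverseʳ a = sqDist-self u

neg-involutive : ∀ {n} (u : Vec ℤ n) → neg (neg u) ≡ u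
neg-involutive [] = refl
neg-involutive (a ∷ u) = cong₂ _∷_ (ℤₚ.neg-involutive a) (neg-involutive u)

neg-injective : ∀ {n} (u v : Vec ℤ n) → neg u ≡ neg v → u ≡ v
neg-injective u v eq = begin
  u             ≡⟨ neg-involutive u ⟨
  neg (neg u)   ≡⟨ cong neg eq ⟩
  neg (neg v)   ≡⟨ neg-involutive v ⟩
  v             ∎
  where open ≡-Reasoning

sqDist≤ : ∀ {n} (u v : Vec ℤ n) → sqDist u v ≤ 2 * sqNorm u + 2 * sqNorm v
sqDist≤ u v = subst (sqDist u v ≤_) (parallelogram u v) (m≤m+n _ _)

sqDist-antipodal : ∀ {n} (u : Vec ℤ n) → sqDist u (neg u) ≡ 2 * sqNorm u + 2 * sqNorm (neg u)
sqDist-antipodal u = begin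
  sqDist u (neg u)                            ≡⟨ +-identityʳ _ ⟨
  sqDist u (neg u) + 0                        ≡⟨ cong (λ d → sqDist u (neg u) + d) (sqDist-self u) ⟨
  sqDist u (neg u) + sqDist u u               ≡⟨ cong (λ w → sqDist u (neg u) + sqDist u w) (neg-involutive u) ⟨
  sqDist u (neg u) + sqDist u (neg (neg u))   ≡⟨ parallelogram u (neg u) ⟩
  2 * sqNorm u + 2 * sqNorm (neg u)           ∎
  where open ≡-Reasoning

sqDist-extremal : ∀ {n} (u v : Vec ℤ n) → sqDist u v ≡ 2 * sqNorm u + 2 * sqNorm v → v ≡ neg u
sqDist-extremal u v eq = begin
  v             ≡⟨ neg-involutive v ⟨
  neg (neg v)   ≡⟨ cong neg (sqDist≡0⇒≡ u (neg v) |u+v|²≡0) ⟨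
  neg u         ∎
  where
  open ≡-Reasoning
  |u+v|²≡0 : sqDist u (neg v) ≡ 0
  |u+v|²≡0 = +-cancelˡ-≡ (sqDist u v) _ 0 (trans (parallelogram u v) (trans (sym eq) (sym (+-identityʳ _))))

negatives zeros positives : ∀ {n} → Vec ℤ n → ℕ
negatives = count (_≟ -1ℤ)
zeros = count (_≟ 0ℤ)
positives = count (_≟ 1ℤ)

Counts : ∀ {n} → ℕ → ℕ → ℕ → Vec ℤ n → Set
Counts a b c v = (negatives v ≡ a) × (zeros v ≡ b) × (positives v ≡ c)

counts-∷-1 : ∀ {n a b c} (w : Vec ℤ n) → Counts a b c w → Counts (suc a) b c (-1ℤ ∷ w)
counts-∷-1 w (#-1 , #0 , #1) = cong suc #-1 , #0 , #1

counts-∷0 : ∀ {n a b c} (w : Vec ℤ n) → Counts a b c w → Counts a (suc b) c (0ℤ ∷ w)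
counts-∷0 w (#-1 , #0 , #1) = #-1 , cong suc #0 , #1

counts-∷1 : ∀ {n a b c} (w : Vec ℤ n) → Counts a b c w → Counts a b (suc c) (1ℤ ∷ w)
counts-∷1 w (#-1 , #0 , #1) = #-1 , #0 , cong suc #1

count-neg : ∀ {n} y (v : Vec ℤ n) → count (_≟ - y) (neg v) ≡ count (_≟ y) v
count-neg y [] = refl
count-neg y (x ∷ v) with x ≟ y | - x ≟ - y
... | yes _ | yes _ = cong suc (count-neg y v)
... | no _ | no _ = count-neg y v
... | yes x≡y | no -x≢-y = contradiction (cong -_ x≡y) -x≢-y
... | no x≢y | yes -x≡-y = contradiction (ℤₚ.neg-injective -x≡-y) x≢y

counts-neg : ∀ {n a b c} {v : Vec ℤ n} → Counts a b c v → Counts c b a (neg v)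
counts-neg {v = v} (#-1≡a , #0≡b , #1≡c) =
  trans (count-neg 1ℤ v) #1≡c , trans (count-neg 0ℤ v) #0≡b , trans (count-neg -1ℤ v) #-1≡a

data Trit : ℤ → Set where
  trit-1 : Trit -1ℤ
  trit0  : Trit 0ℤ
  trit1  : Trit 1ℤ

Ternary : ∀ {n} → Vec ℤ n → Set
Ternary = VecAll.All Trit

total : ∀ {n} → Vec ℤ n → ℕ
total v = negatives v + zeros v + positives v

data Entry (x : ℤ) : Set where
  trit  : Trit x → Entry x
  other : (∀ {n} (v : Vec ℤ n) → total (x ∷ v) ≡ total v) → Entry x

entry : ∀ x → Entry x
entry -[1+ 0 ] = trit trit-1
entry (pos 0) = trit trit0
entry (pos 1) = trit trit1
entry (pos (suc (suc _))) = other λ _ → refl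
entry -[1+ suc _ ] = other λ _ → refl

total-trit : ∀ {n x} → Trit x → (v : Vec ℤ n) → total (x ∷ v) ≡ suc (total v)
total-trit trit-1 v = refl
total-trit trit0 v = cong (_+ positives v) (+-suc (negatives v) (zeros v))
total-trit trit1 v = +-suc (negatives v + zeros v) (positives v)

total≤ : ∀ {n} (v : Vec ℤ n) → total v ≤ n
total≤ [] = z≤n
total≤ (x ∷ v) with entry x
... | trit t = ≤-trans (≤-reflexive (total-trit t v)) (s≤s (total≤ v))
... | other same = ≤-trans (≤-reflexive (same v)) (m≤n⇒m≤1+n (total≤ v))

ternary-from-total : ∀ {n} (v : Vec ℤ n) → total v ≡ n → Ternary v
ternary-from-total [] _ = []
ternary-from-total (x ∷ v) eq with entry x
... | trit t = t ∷ ternary-from-total v (suc-injective (trans (sym (total-trit t v)) eq))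
... | other same = ⊥-elim (1+n≰n (≤-trans (≤-reflexive (trans (sym eq) (same v))) (total≤ v)))

counts-ternary : ∀ {n a b c} (v : Vec ℤ n) → a + b + c ≡ n → Counts a b c v → Ternary v
counts-ternary v a+b+c≡n (refl , refl , refl) = ternary-from-total v a+b+c≡n

sqNorm-ternary : ∀ {n} {v : Vec ℤ n} → Ternary v → sqNorm v ≡ negatives v + positives v
sqNorm-ternary [] = refl
sqNorm-ternary (trit-1 ∷ t) = cong suc (sqNorm-ternary t)
sqNorm-ternary (trit0 ∷ t) = sqNorm-ternary t
sqNorm-ternary {v = _ ∷ v} (trit1 ∷ t) =
  trans (cong suc (sqNorm-ternary t)) (sym (+-suc (negatives v) (positives v)))

sqNorm-counts : ∀ {n a b c} (v : Vec ℤ n) → a + b + c ≡ n → Counts a b c v → sqNorm v ≡ a + c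
sqNorm-counts v a+b+c≡n counts@(refl , refl , refl) = sqNorm-ternary (counts-ternary v a+b+c≡n counts)

-- the point (-1,…,-1,0,…,0,1,…,1) of L_{abc}; it shows L_{abc} ≠ ∅
sorted : ∀ a b c → Vec ℤ (a + b + c)
sorted (suc a) b c = -1ℤ ∷ sorted a b c
sorted zero (suc b) c = 0ℤ ∷ sorted zero b c
sorted zero zero (suc c) = 1ℤ ∷ sorted zero zero c
sorted zero zero zero = []

sorted-counts : ∀ a b c → Counts a b c (sorted a b c)
sorted-counts (suc a) b c = counts-∷-1 (sorted a b c) (sorted-counts a b c)
sorted-counts zero (suc b) c = counts-∷0 (sorted zero b c) (sorted-counts zero b c)
sorted-counts zero zero (suc c) = counts-∷1 (sorted zero zero c) (sorted-counts zero zero c)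
sorted-counts zero zero zero = refl , refl , refl

-- the first nonzero entry of a vector (0 for the zero vector); its sign
-- selects one point from each antipodal pair
leading : ∀ {n} → Vec ℤ n → ℤ
leading [] = 0ℤ
leading (x ∷ v) = if does (x ≟ 0ℤ) then leading v else x

leading-trit : ∀ {n} {v : Vec ℤ n} → Ternary v → Trit (leading v)
leading-trit [] = trit0
leading-trit (trit-1 ∷ _) = trit-1
leading-trit (trit0 ∷ t) = leading-trit t
leading-trit (trit1 ∷ _) = trit1

leading-neg : ∀ {n} {v : Vec ℤ n} → Ternary v → leading (neg v) ≡ - leading v
leading-neg [] = refl
leading-neg (trit-1 ∷ _) = refl
leading-neg (trit0 ∷ t) = leading-neg t
leading-neg (trit1 ∷ _) = refl

leading≡0 : ∀ {n} {v : Vec ℤ n} → Ternary v → leading v ≡ 0ℤ → negatives v ≡ 0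
leading≡0 [] _ = refl
leading≡0 (trit0 ∷ t) eq = leading≡0 t eq

-- The trinomial coefficient C(n, a) C(b+c, c) (for a + b + c = n) satisfies
-- the recursion that splits L_{abc} ⊂ ℤ^(n+1) by the first entry.

atPred : (ℕ → ℕ) → ℕ → ℕ
atPred f zero = 0
atPred f (suc a) = f a

pascal : ∀ n a x → atPred (λ a' → (n C a') * x) a + (n C a) * x ≡ (suc n C a) * x
pascal n zero x = refl
pascal n (suc a) x =
  trans (sym (*-distribʳ-+ x (n C a) (n C suc a))) (cong (_* x) (nCk+nC[k+1]≡[n+1]C[k+1] n a))

pascal₂ : ∀ y b c → .{{NonZero (b + c)}} →
  atPred (λ b' → y * ((b' + c) C c)) b + atPred (λ c' → y * ((b + c') C c')) c ≡ y * ((b + c) C c)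
pascal₂ y zero (suc c) = cong (y *_) (trans (nCn≡1 c) (sym (nCn≡1 (suc c))))
pascal₂ y (suc b) zero = +-identityʳ (y * 1)
pascal₂ y (suc b) (suc c) rewrite +-suc b c =
  trans (sym (*-distribˡ-+ y (suc (b + c) C suc c) (suc (b + c) C c)))
    (cong (y *_) (trans (+-comm (suc (b + c) C suc c) _) (nCk+nC[k+1]≡[n+1]C[k+1] (suc (b + c)) c)))

trinomial-step : ∀ n a b c → a + b + c ≡ suc n →
  atPred (λ a' → (n C a') * ((b + c) C c)) a +
    (atPred (λ b' → (n C a) * ((b' + c) C c)) b + atPred (λ c' → (n C a) * ((b + c') C c')) c)
  ≡ (suc n C a) * ((b + c) C c)
trinomial-step n a zero zero a+0+0≡1+n =
  trans (cong (atPred (λ a' → (n C a') * 1) a +_) (cong (_* 1) (sym (k>n⇒nCk≡0 a>n)))) (pascal n a 1)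
  where
  a>n : n < a
  a>n = subst (n <_) (trans (sym a+0+0≡1+n) (trans (+-identityʳ (a + 0)) (+-identityʳ a))) (n<1+n n)
trinomial-step n a b@(suc _) c _ =
  trans (cong (atPred (λ a' → (n C a') * ((b + c) C c)) a +_) (pascal₂ (n C a) b c)) (pascal n a ((b + c) C c))
trinomial-step n a zero c@(suc _) _ =
  trans (cong (atPred (λ a' → (n C a') * (c C c)) a +_) (pascal₂ (n C a) zero c)) (pascal n a (c C c))

prepend : ∀ {n} → ℤ → ℕ → (ℕ → List (Vec ℤ n)) → List (Vec ℤ (suc n))
prepend h zero g = []
prepend h (suc a) g = map (h ∷_) (g a)

ternaries : (n a b c : ℕ) → List (Vec ℤ n)
ternaries zero zero zero zero = [] ∷ []
ternaries zero _ _ _ = []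
ternaries (suc n) a b c =
  prepend -1ℤ a (λ a' → ternaries n a' b c) ++
  prepend 0ℤ b (λ b' → ternaries n a b' c) ++
  prepend 1ℤ c (λ c' → ternaries n a b c')

prepend-All : ∀ {n} {P : Vec ℤ (suc n) → Set} h a (g : ℕ → List (Vec ℤ n)) →
  (∀ {a'} → a ≡ suc a' → All (λ w → P (h ∷ w)) (g a')) → All P (prepend h a g)
prepend-All h zero g _ = []
prepend-All h (suc a) g all = Allₚ.map⁺ (all refl)

ternaries-sound : ∀ n a b c → All (Counts a b c) (ternaries n a b c)
ternaries-sound zero zero zero zero = (refl , refl , refl) ∷ []
ternaries-sound zero zero zero (suc _) = []
ternaries-sound zero zero (suc _) _ = []
ternaries-sound zero (suc _) _ _ = []
ternaries-sound (suc n) a b c =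
  Allₚ.++⁺ (prepend-All -1ℤ a _ λ { refl → ListAll.map (λ {w} → counts-∷-1 w) (ternaries-sound n _ b c) })
  (Allₚ.++⁺ (prepend-All 0ℤ b _ λ { refl → ListAll.map (λ {w} → counts-∷0 w) (ternaries-sound n a _ c) })
            (prepend-All 1ℤ c _ λ { refl → ListAll.map (λ {w} → counts-∷1 w) (ternaries-sound n a b _) }))

ternaries-complete : ∀ {n} {v : Vec ℤ n} → Ternary v → v ∈ ternaries n (negatives v) (zeros v) (positives v)
ternaries-complete [] = here refl
ternaries-complete (trit-1 ∷ t) = ∈-++⁺ˡ (∈-map⁺ (-1ℤ ∷_) (ternaries-complete t))
ternaries-complete {v = _ ∷ w} (trit0 ∷ t) =
  ∈-++⁺ʳ (prepend -1ℤ (negatives w) _) (∈-++⁺ˡ (∈-map⁺ (0ℤ ∷_) (ternaries-complete t)))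
ternaries-complete {v = _ ∷ w} (trit1 ∷ t) =
  ∈-++⁺ʳ (prepend -1ℤ (negatives w) _)
    (∈-++⁺ʳ (prepend 0ℤ (zeros w) _) (∈-map⁺ (1ℤ ∷_) (ternaries-complete t)))

∈-ternaries : ∀ {n a b c} → a + b + c ≡ n → (v : Vec ℤ n) → v ∈ ternaries n a b c ⇔ Counts a b c v
∈-ternaries {n} {a} {b} {c} a+b+c≡n v = mk⇔ (ListAll.lookup (ternaries-sound n a b c)) from
  where
  from : Counts a b c v → v ∈ ternaries n a b c
  from counts@(refl , refl , refl) = ternaries-complete (counts-ternary v a+b+c≡n counts)

head-prepend : ∀ {n} h a (g : ℕ → List (Vec ℤ n)) {v} → v ∈ prepend h a g → head v ≡ h
head-prepend h (suc a) g v∈ with ∈-map⁻ (h ∷_) v∈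
... | _ , _ , refl = refl

prepend-disjoint : ∀ {n} {h h'} a b (g g' : ℕ → List (Vec ℤ n)) → h ≢ h' →
                   Disjoint (prepend h a g) (prepend h' b g')
prepend-disjoint a b g g' h≢h' (v∈ , v∈') = h≢h' (trans (sym (head-prepend _ a g v∈)) (head-prepend _ b g' v∈'))

prepend-unique : ∀ {n} h a (g : ℕ → List (Vec ℤ n)) → (∀ a' → Unique (g a')) → Unique (prepend h a g)
prepend-unique h zero g _ = []
prepend-unique h (suc a) g unique = Uniqueₚ.map⁺ Vecₚ.∷-injectiveʳ (unique a)

disjoint-++ : ∀ {A : Set} {xs ys zs : List A} → Disjoint xs ys → Disjoint xs zs → Disjoint xs (ys ++ zs)
disjoint-++ {ys = ys} xs#ys xs#zs (x∈xs , x∈ys++zs) =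
  [ (λ x∈ys → xs#ys (x∈xs , x∈ys)) , (λ x∈zs → xs#zs (x∈xs , x∈zs)) ]′ (∈-++⁻ ys x∈ys++zs)

-- the enumeration has no repetitions: the three groups differ in their first entry
ternaries-unique : ∀ n a b c → Unique (ternaries n a b c)
ternaries-unique zero zero zero zero = [] ∷ []
ternaries-unique zero zero zero (suc _) = []
ternaries-unique zero zero (suc _) _ = []
ternaries-unique zero (suc _) _ _ = []
ternaries-unique (suc n) a b c =
  Uniqueₚ.++⁺ (prepend-unique -1ℤ a _ λ a' → ternaries-unique n a' b c)
    (Uniqueₚ.++⁺ (prepend-unique 0ℤ b _ λ b' → ternaries-unique n a b' c)
                 (prepend-unique 1ℤ c _ λ c' → ternaries-unique n a b c')
                 (prepend-disjoint b c _ _ λ ()))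
    (disjoint-++ (prepend-disjoint a b _ _ λ ()) (prepend-disjoint a c _ _ λ ()))

length-prepend : ∀ {n} h a (g : ℕ → List (Vec ℤ n)) (f : ℕ → ℕ) →
  (∀ {a'} → a ≡ suc a' → length (g a') ≡ f a') → length (prepend h a g) ≡ atPred f a
length-prepend h zero g f _ = refl
length-prepend h (suc a) g f length-g = trans (length-map (h ∷_) (g a)) (length-g refl)

length-ternaries : ∀ n a b c → a + b + c ≡ n → length (ternaries n a b c) ≡ (n C a) * ((b + c) C c)
length-ternaries zero zero zero zero _ = refl
length-ternaries (suc n) a b c a+b+c≡1+n = begin
  length (L₋ ++ L₀ ++ L₊)                   ≡⟨ length-++ L₋ ⟩
  length L₋ + length (L₀ ++ L₊)             ≡⟨ cong (length L₋ +_) (length-++ L₀) ⟩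
  length L₋ + (length L₀ + length L₊)       ≡⟨ cong₂ _+_ length-L₋ (cong₂ _+_ length-L₀ length-L₊) ⟩
  atPred (λ a' → (n C a') * ((b + c) C c)) a +
    (atPred (λ b' → (n C a) * ((b' + c) C c)) b + atPred (λ c' → (n C a) * ((b + c') C c')) c)
                                            ≡⟨ trinomial-step n a b c a+b+c≡1+n ⟩
  (suc n C a) * ((b + c) C c)               ∎
  where
  open ≡-Reasoning
  L₋ = prepend -1ℤ a (λ a' → ternaries n a' b c)
  L₀ = prepend 0ℤ b (λ b' → ternaries n a b' c)
  L₊ = prepend 1ℤ c (λ c' → ternaries n a b c')
  length-L₋ = length-prepend -1ℤ a _ _ λ { refl → length-ternaries n _ b c (suc-injective a+b+c≡1+n) }
  length-L₀ = length-prepend 0ℤ b _ _ λ { {b'} refl →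
    length-ternaries n a b' c (suc-injective (trans (sym (cong (_+ c) (+-suc a b'))) a+b+c≡1+n)) }
  length-L₊ = length-prepend 1ℤ c _ _ λ { {c'} refl →
    length-ternaries n a b c' (suc-injective (trans (sym (+-suc (a + b) c')) a+b+c≡1+n)) }

module Layer (m k : ℕ) where

  open import Data.List.Membership.DecPropositional (Vecₚ.≡-dec {n = m + k + m} ℤ._≟_) using (_∈?_)

  L : List (Vec ℤ (m + k + m))
  L = ternaries (m + k + m) m k m

  ∈L⇔ : ∀ v → v ∈ L ⇔ InL m k m v
  ∈L⇔ = ∈-ternaries refl

  ∈L : ∀ {v} → InL m k m v → v ∈ L
  ∈L {v} = Equivalence.from (∈L⇔ v)

  L-unique : Unique L
  L-unique = ternaries-unique (m + k + m) m k m

  |L| : ℕ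
  |L| = ((m + k + m) C m) * ((k + m) C m)

  length-L : length L ≡ |L|
  length-L = length-ternaries (m + k + m) m k m refl

  enumeration-length : (Ls : List (Vec ℤ (m + k + m))) → Unique Ls →
                       (∀ v → v ∈ Ls ⇔ InL m k m v) → length Ls ≡ |L|
  enumeration-length Ls Ls-unique ∈Ls⇔ = trans
    (≤-antisym (unique-⊆-length≤ Ls-unique L-unique (∈L ∘ Equivalence.to (∈Ls⇔ _)))
               (unique-⊆-length≤ L-unique Ls-unique (Equivalence.from (∈Ls⇔ _) ∘ Equivalence.to (∈L⇔ _))))
    length-L

  InL-neg : ∀ v → InL m k m v → InL m k m (neg v)
  InL-neg v = counts-neg {v = v}

  -- every point of L_{mkm} has squared norm 2m, so by the parallelogram law
  -- D(L)² = 2·2m + 2·2m, attained exactly by the antipodal pairs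
  diam² : ℕ
  diam² = 2 * (m + m) + 2 * (m + m)

  sqNorm-L : ∀ u → InL m k m u → sqNorm u ≡ m + m
  sqNorm-L u = sqNorm-counts {a = m} {b = k} {c = m} u refl

  norms-L : ∀ u v → InL m k m u → InL m k m v → 2 * sqNorm u + 2 * sqNorm v ≡ diam²
  norms-L u v u∈L v∈L = cong₂ (λ p q → 2 * p + 2 * q) (sqNorm-L u u∈L) (sqNorm-L v v∈L)

  L-sqDist≤ : ∀ u v → InL m k m u → InL m k m v → sqDist u v ≤ diam²
  L-sqDist≤ u v u∈L v∈L = subst (sqDist u v ≤_) (norms-L u v u∈L v∈L) (sqDist≤ u v)

  L-antipodal : ∀ u → InL m k m u → sqDist u (neg u) ≡ diam²
  L-antipodal u u∈L = trans (sqDist-antipodal u) (norms-L u (neg u) u∈L (InL-neg u u∈L))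

  L-extremal : ∀ u v → InL m k m u → InL m k m v → sqDist u v ≡ diam² → v ≡ neg u
  L-extremal u v u∈L v∈L eq = sqDist-extremal u v (trans eq (sym (norms-L u v u∈L v∈L)))

  AntipodeFree : List (Vec ℤ (m + k + m)) → Set
  AntipodeFree X = ∀ {x} → x ∈ X → neg x ∉ X

  small⇒antipodeFree : ∀ {X} → All (InL m k m) X → SmallDiam m k m X → AntipodeFree X
  small⇒antipodeFree X⊆L (a , b , a∈L , b∈L , small) {x} x∈X -x∈X =
    <⇒≱ (subst (_< sqDist a b) (L-antipodal x (ListAll.lookup X⊆L x∈X)) (small x (neg x) x∈X -x∈X))
        (L-sqDist≤ a b a∈L b∈L)

  antipodeFree⇒small : ∀ {X} → All (InL m k m) X → AntipodeFree X → SmallDiam m k m X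
  antipodeFree⇒small {X} X⊆L free =
    a , neg a , a∈L , InL-neg a a∈L , λ x y x∈X y∈X → subst (sqDist x y <_) (sym (L-antipodal a a∈L))
      (≤∧≢⇒< (L-sqDist≤ x y (inL x∈X) (inL y∈X))
        λ eq → free x∈X (subst (_∈ X) (L-extremal x y (inL x∈X) (inL y∈X) eq) y∈X))
    where
    a = sorted m k m
    a∈L = sorted-counts m k m
    inL : ∀ {x} → x ∈ X → InL m k m x
    inL = ListAll.lookup X⊆L

  doubled : List (Vec ℤ (m + k + m)) → List (Vec ℤ (m + k + m))
  doubled X = X ++ map neg X

  length-doubled : ∀ X → length (doubled X) ≡ 2 * length X
  length-doubled X = begin
    length (X ++ map neg X)           ≡⟨ length-++ X ⟩
    length X + length (map neg X)     ≡⟨ cong (length X +_) (length-map neg X) ⟩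
    length X + length X               ≡⟨ cong (length X +_) (sym (+-identityʳ (length X))) ⟩
    2 * length X                      ∎
    where open ≡-Reasoning

  ∈-doubled⁻ : ∀ {X v} → v ∈ doubled X → (v ∈ X) ⊎ (neg v ∈ X)
  ∈-doubled⁻ {X} v∈ with ∈-++⁻ X v∈
  ... | inj₁ v∈X = inj₁ v∈X
  ... | inj₂ v∈-X with ∈-map⁻ neg v∈-X
  ...   | x , x∈X , refl = inj₂ (subst (_∈ X) (sym (neg-involutive x)) x∈X)

  doubled-unique : ∀ {X} → Unique X → AntipodeFree X → Unique (doubled X)
  doubled-unique {X} X-unique free =
    Uniqueₚ.++⁺ X-unique (Uniqueₚ.map⁺ (neg-injective _ _) X-unique) λ (v∈X , v∈-X) → disjoint v∈X v∈-X
    where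
    disjoint : ∀ {v} → v ∈ X → v ∉ map neg X
    disjoint v∈X v∈-X with ∈-map⁻ neg v∈-X
    ... | x , x∈X , refl = free x∈X v∈X

  doubled-⊆L : ∀ {X} → All (InL m k m) X → doubled X ⊆ L
  doubled-⊆L X⊆L {v} v∈ with ∈-doubled⁻ v∈
  ... | inj₁ v∈X = ∈L (ListAll.lookup X⊆L v∈X)
  ... | inj₂ -v∈X = subst (_∈ L) (neg-involutive _) (∈L (InL-neg (neg v) (ListAll.lookup X⊆L -v∈X)))

  antipodeFree-bound : ∀ {X} → Unique X → All (InL m k m) X → AntipodeFree X → 2 * length X ≤ |L|
  antipodeFree-bound {X} X-unique X⊆L free = subst₂ _≤_ (length-doubled X) length-L
    (unique-⊆-length≤ (doubled-unique X-unique free) L-unique (doubled-⊆L X⊆L))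

  antipodal⇒antipodeFree : ∀ {X} → All (InL m k m) X → Antipodal1 m k m X → AntipodeFree X
  antipodal⇒antipodeFree X⊆L choice {x} x∈X -x∈X with choice x (ListAll.lookup X⊆L x∈X)
  ... | inj₁ (_ , -x∉X) = -x∉X -x∈X
  ... | inj₂ (x∉X , _) = x∉X x∈X

  antipodal⇒half : ∀ {X} → Unique X → All (InL m k m) X → Antipodal1 m k m X → 2 * length X ≡ |L|
  antipodal⇒half {X} X-unique X⊆L choice = ≤-antisym
    (antipodeFree-bound X-unique X⊆L free)
    (subst₂ _≤_ length-L (length-doubled X) (unique-⊆-length≤ L-unique (doubled-unique X-unique free) L⊆doubled))
    where
    free = antipodal⇒antipodeFree X⊆L choice
    L⊆doubled : L ⊆ doubled X
    L⊆doubled {v} v∈L with choice v (Equivalence.to (∈L⇔ v) v∈L)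
    ... | inj₁ (v∈X , _) = ∈-++⁺ˡ v∈X
    ... | inj₂ (_ , -v∈X) = ∈-++⁺ʳ X (subst (_∈ map neg X) (neg-involutive v) (∈-map⁺ neg -v∈X))

  half⇒antipodal : ∀ {X} → Unique X → All (InL m k m) X → AntipodeFree X → 2 * length X ≡ |L| →
                   Antipodal1 m k m X
  half⇒antipodal {X} X-unique X⊆L free half x x∈L with x ∈? X | neg x ∈? X
  ... | yes x∈X | _ = inj₁ (x∈X , free x∈X)
  ... | no x∉X | yes -x∈X = inj₂ (x∉X , -x∈X)
  ... | no x∉X | no -x∉X = ⊥-elim (<-irrefl (trans (length-doubled X) (trans half (sym length-L)))
    (unique-⊆-length< (doubled-unique X-unique free) L-unique (doubled-⊆L X⊆L) (∈L x∈L) x∉doubled))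
    where
    x∉doubled : x ∉ doubled X
    x∉doubled x∈ with ∈-doubled⁻ {X} x∈
    ... | inj₁ x∈X = x∉X x∈X
    ... | inj₂ -x∈X = -x∉X -x∈X

  leads1? : Decidable (λ (v : Vec ℤ (m + k + m)) → leading v ≡ 1ℤ)
  leads1? v = leading v ≟ 1ℤ

  X₀ : List (Vec ℤ (m + k + m))
  X₀ = filter leads1? L

  X₀-unique : Unique X₀
  X₀-unique = Uniqueₚ.filter⁺ leads1? L-unique

  X₀-⊆L : All (InL m k m) X₀
  X₀-⊆L = ListAll.tabulate λ {v} v∈X₀ →
    Equivalence.to (∈L⇔ v) (proj₁ (∈-filter⁻ leads1? {xs = L} v∈X₀))

  -- for m ≥ 1 every point of L has a first nonzero entry ±1, which changes
  -- sign under x ↦ -x; so X₀ contains exactly one point of each pair x, -x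
  X₀-antipodal : 1 ≤ m → Antipodal1 m k m X₀
  X₀-antipodal m≥1 x x∈L = select (leading-trit ternary) refl
    where
    ternary = counts-ternary x refl x∈L
    leads1 : ∀ {v} → v ∈ X₀ → leading v ≡ 1ℤ
    leads1 v∈X₀ = proj₂ (∈-filter⁻ leads1? {xs = L} v∈X₀)
    -1≢1 : -1ℤ ≢ 1ℤ
    -1≢1 ()
    select : ∀ {f} → Trit f → leading x ≡ f →
             ((x ∈ X₀) × (neg x ∉ X₀)) ⊎ ((x ∉ X₀) × (neg x ∈ X₀))
    select trit1 lead≡1 = inj₁ (∈-filter⁺ leads1? (∈L x∈L) lead≡1 ,
      λ -x∈X₀ → -1≢1 (trans (sym (trans (leading-neg ternary) (cong -_ lead≡1))) (leads1 -x∈X₀)))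
    select trit-1 lead≡-1 = inj₂ ((λ x∈X₀ → -1≢1 (trans (sym lead≡-1) (leads1 x∈X₀))) ,
      ∈-filter⁺ leads1? (∈L (InL-neg x x∈L)) (trans (leading-neg ternary) (cong -_ lead≡-1)))
    select trit0 lead≡0 = ⊥-elim (<⇒≢ m≥1 (sym (trans (sym (proj₁ x∈L)) (leading≡0 ternary lead≡0))))

proposition2p1 : (m k : ℕ) → 1 ≤ m →
    ((Ls : List (Vec ℤ (m + k + m))) → Unique Ls →
      (∀ v → (v ∈ Ls) ⇔ InL m k m v) →
      length Ls ≡ ((m + k + m) C m) * ((k + m) C m))
    × (Σ (List (Vec ℤ (m + k + m))) λ X →
        Unique X × All (InL m k m) X × SmallDiam m k m X ×
        2 * length X ≡ ((m + k + m) C m) * ((k + m) C m))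
    × ((X : List (Vec ℤ (m + k + m))) → Unique X → All (InL m k m) X →
        SmallDiam m k m X →
        2 * length X ≤ ((m + k + m) C m) * ((k + m) C m))
    × ((X : List (Vec ℤ (m + k + m))) → Unique X → All (InL m k m) X →
        ((SmallDiam m k m X × 2 * length X ≡ ((m + k + m) C m) * ((k + m) C m))
          ⇔ Antipodal1 m k m X))
proposition2p1 m k m≥1 =
    enumeration-length
  , (X₀ , X₀-unique , X₀-⊆L , antipodeFree⇒small X₀-⊆L (antipodal⇒antipodeFree X₀-⊆L X₀-choice)
        , antipodal⇒half X₀-unique X₀-⊆L X₀-choice)
  , (λ X X-unique X⊆L small → antipodeFree-bound X-unique X⊆L (small⇒antipodeFree X⊆L small))
  , λ X X-unique X⊆L → mk⇔
      (λ (small , half) → half⇒antipodal X-unique X⊆L (small⇒antipodeFree X⊆L small) half)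
      (λ choice → antipodeFree⇒small X⊆L (antipodal⇒antipodeFree X⊆L choice)
                , antipodal⇒half X-unique X⊆L choice)
  where
  open Layer m k
  X₀-choice : Antipodal1 m k m X₀
  X₀-choice = X₀-antipodal m≥1
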